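{- Let $Th$ and $M$ be theories in first-order logic with equality, and let $m$ be a modelling transformation from $Th$ to $M$. Write $E(x,y)$ for the formula $m(x=y)$, the image under $m$ of the atomic equality formula of $Th$, regarded as a binary relation in its two free variables. Then $M$ proves that $E$ is an equivalence relation, i.e. $M\vdash \forall x\, E(x,x)$, $M\vdash\forall x\forall y\,(E(x,y)\to E(y,x))$ and $M\vdash \forall x\forall y\forall z\,(E(x,y)\wedge E(y,z)\to E(x,z))$.
   Context: A theory is given by a language and a set of axioms over the predicate calculus; $T\vdash S$ means $S$ is derivable in $T$. For a formula (predicate) $P$ with a free variable and a term $t$, $\mathrm{sub}(P,t)$ denotes the result of substituting $t$ for the free variable of $P$. A modelling transformation from $Th$ to $M$ is a function $m$ from the strings of $Th$ to the strings of $M$ such that: (1) $m$ maps terms of $Th$ to terms of $M$, predicates (formulas with free variables) of $Th$ to predicates of $M$, and sentences of $Th$ to sentences of $M$; (2) for all sentences $S,T$, predicates $P$ and terms $t$ of $Th$: $M\vdash m(\neg S)\leftrightarrow\neg m(S)$, $M\vdash m(S\vee T)\leftrightarrow m(S)\vee m(T)$, $M\vdash m(\exists x P(x))\leftrightarrow \exists x\, m(P(x))$ (with $x$ free in $P$), and $M\vdash m(\mathrm{sub}(P,t))\leftrightarrow \mathrm{sub}(m(P),m(t))$; (3) $m$ preserves provability: if $Th\vdash S$ then $M\vdash m(S)$. -}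

module Defs where

open import Data.Nat using (ℕ; zero; suc)
open import Data.Fin using (Fin; zero; suc; _≟_; punchOut)
open import Relation.Nullary using (yes; no)
open import Relation.Binary.PropositionalEquality using (sym)
open import Data.Vec using (Vec; []; _∷_)
open import Relation.Binary.PropositionalEquality using (_≡_)

-- First-order languages (function and relation symbols, indexed by arity).
-- Equality is a logical symbol, built into the syntax of formulas.

record Language : Set₁ where
  field
    Func : ℕ → Set
    Rel  : ℕ → Set

open Language public

module _ (L : Language) where

  data Term (n : ℕ) : Set where
    var : Fin n → Term n
    fn  : ∀ {k} → Func L k → Vec (Term n) k → Term n

  data Formula (n : ℕ) : Set where
    rel  : ∀ {k} → Rel L k → Vec (Term n) k → Formula n
    _≐_  : Term n → Term n → Formula n
    ¬'_  : Formula n → Formula n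
    _∨'_ : Formula n → Formula n → Formula n
    ∃'   : Formula (suc n) → Formula n

  infix  7 _≐_
  infixr 6 ¬'_
  infixr 5 _∨'_


module _ {L : Language} where

  Subst : ℕ → ℕ → Set
  Subst n m = Fin n → Term L m

  mutual
    renT : ∀ {n m} → (Fin n → Fin m) → Term L n → Term L m
    renT ρ (var i)   = var (ρ i)
    renT ρ (fn f ts) = fn f (renTs ρ ts)

    renTs : ∀ {n m k} → (Fin n → Fin m) → Vec (Term L n) k → Vec (Term L m) k
    renTs ρ []       = []
    renTs ρ (t ∷ ts) = renT ρ t ∷ renTs ρ ts

  mutual
    subT : ∀ {n m} → Subst n m → Term L n → Term L m
    subT σ (var i)   = σ i
    subT σ (fn f ts) = fn f (subTs σ ts)

    subTs : ∀ {n m k} → Subst n m → Vec (Term L n) k → Vec (Term L m) k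
    subTs σ []       = []
    subTs σ (t ∷ ts) = subT σ t ∷ subTs σ ts

  exts : ∀ {n m} → Subst n m → Subst (suc n) (suc m)
  exts σ zero    = var zero
  exts σ (suc i) = renT suc (σ i)

  subF : ∀ {n m} → Subst n m → Formula L n → Formula L m
  subF σ (rel r ts) = rel r (subTs σ ts)
  subF σ (t ≐ u)    = subT σ t ≐ subT σ u
  subF σ (¬' A)     = ¬' subF σ A
  subF σ (A ∨' B)   = subF σ A ∨' subF σ B
  subF σ (∃' A)     = ∃' (subF (exts σ) A)

  weaken : ∀ {n} → Formula L n → Formula L (suc n)
  weaken = subF (λ i → var (suc i))

  close : ∀ {n} → Formula L 0 → Formula L n
  close = subF (λ ())

  sub : ∀ {n} → Formula L (suc n) → Term L n → Formula L n
  sub P t = subF σ P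
    where
    σ : Subst _ _
    σ zero    = t
    σ (suc i) = var i

  subAt : ∀ {n} → Formula L (suc n) → Fin (suc n) → Term L n → Formula L n
  subAt P i t = subF σ P
    where
    σ : Subst _ _
    σ j with i ≟ j
    ... | yes _  = t
    ... | no i≢j = var (punchOut i≢j)

  infixr 4 _⇒_
  infix  3 _⇔_
  infixr 6 _∧'_

  _⇒_ : ∀ {n} → Formula L n → Formula L n → Formula L n
  A ⇒ B = ¬' A ∨' B

  _∧'_ : ∀ {n} → Formula L n → Formula L n → Formula L n
  A ∧' B = ¬' (¬' A ∨' ¬' B)

  _⇔_ : ∀ {n} → Formula L n → Formula L n → Formula L n
  A ⇔ B = (A ⇒ B) ∧' (B ⇒ A)

  ∀' : ∀ {n} → Formula L (suc n) → Formula L n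
  ∀' A = ¬' ∃' (¬' A)

  eqs⇒ : ∀ {n k} → Vec (Term L n) k → Vec (Term L n) k → Formula L n → Formula L n
  eqs⇒ []       []       φ = φ
  eqs⇒ (t ∷ ts) (u ∷ us) φ = t ≐ u ⇒ eqs⇒ ts us φ

-- Theories and derivability (Shoenfield's Hilbert system for
-- first-order logic with equality, primitives ¬, ∨, ∃, in de Bruijn form).
-- T ⊢ φ for φ with n free variables means φ is a theorem of T
-- (free variables read as in Shoenfield, i.e. implicitly universal).

record Theory : Set₁ where
  field
    lang : Language
    Ax   : Formula lang 0 → Set

open Theory public

infix 2 _⊢_

data _⊢_ (T : Theory) : ∀ {n} → Formula (lang T) n → Set where
  ax         : ∀ {n} {φ} → Ax T φ → T ⊢ close {n = n} φ
  prop-ax    : ∀ {n} (A : Formula (lang T) n) → T ⊢ ¬' A ∨' A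
  subst-ax   : ∀ {n} (A : Formula (lang T) (suc n)) (t : Term (lang T) n) →
               T ⊢ sub A t ⇒ ∃' A
  refl-ax    : ∀ {n} (t : Term (lang T) n) → T ⊢ t ≐ t
  eq-fn      : ∀ {n k} (f : Func (lang T) k) (ts us : Vec (Term (lang T) n) k) →
               T ⊢ eqs⇒ ts us (fn f ts ≐ fn f us)
  eq-rel     : ∀ {n k} (r : Rel (lang T) k) (ts us : Vec (Term (lang T) n) k) →
               T ⊢ eqs⇒ ts us (rel r ts ⇒ rel r us)
  eq-eq      : ∀ {n} (t₁ t₂ u₁ u₂ : Term (lang T) n) →
               T ⊢ t₁ ≐ u₁ ⇒ t₂ ≐ u₂ ⇒ t₁ ≐ t₂ ⇒ u₁ ≐ u₂
  expansion   : ∀ {n} (A : Formula (lang T) n) {B} → T ⊢ B → T ⊢ A ∨' B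
  contraction : ∀ {n} {A : Formula (lang T) n} → T ⊢ A ∨' A → T ⊢ A
  associative : ∀ {n} {A B C : Formula (lang T) n} →
                T ⊢ A ∨' (B ∨' C) → T ⊢ (A ∨' B) ∨' C
  cut         : ∀ {n} {A B C : Formula (lang T) n} →
                T ⊢ A ∨' B → T ⊢ ¬' A ∨' C → T ⊢ B ∨' C
  ∃-intro     : ∀ {n} {A : Formula (lang T) (suc n)} {B : Formula (lang T) n} →
                T ⊢ A ⇒ weaken B → T ⊢ ∃' A ⇒ B
  -- a formula not depending on a variable may drop it (nonempty domains)
  strengthen  : ∀ {n} {A : Formula (lang T) n} → T ⊢ weaken A → T ⊢ A

record ModellingTransformation (Th M : Theory) : Set where
  field
    mT : ∀ {n} → Term (lang Th) n → Term (lang M) n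
    mF : ∀ {n} → Formula (lang Th) n → Formula (lang M) n
    -- variables are left unchanged (implicit in "∃x P(x) ↦ ∃x m(P(x))")
    m-var : ∀ {n} (i : Fin n) → mT (var i) ≡ var i
    m-¬   : ∀ {n} (S : Formula (lang Th) n) → M ⊢ mF (¬' S) ⇔ ¬' mF S
    m-∨   : ∀ {n} (S T : Formula (lang Th) n) → M ⊢ mF (S ∨' T) ⇔ mF S ∨' mF T
    m-∃   : ∀ {n} (P : Formula (lang Th) (suc n)) → M ⊢ mF (∃' P) ⇔ ∃' (mF P)
    m-sub : ∀ {n} (P : Formula (lang Th) (suc n)) (x : Fin (suc n))
            (t : Term (lang Th) n) →
            M ⊢ mF (subAt P x t) ⇔ subAt (mF P) x (mT t)
    m-prov : (S : Formula (lang Th) 0) → Th ⊢ S → M ⊢ mF S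

-- The relation E(x,y) := m(x = y), as a formula in two free variables
-- x = var 1, y = var 0, and its instances E(a,b).

module _ {Th M : Theory} (m : ModellingTransformation Th M) where
  open ModellingTransformation m

  E : Formula (lang M) 2
  E = mF (var (suc zero) ≐ var zero)

  E[_,_] : ∀ {n} → Term (lang M) n → Term (lang M) n → Formula (lang M) n
  E[ a , b ] = subF σ E
    where
    σ : Subst 2 _
    σ zero    = b
    σ (suc _) = a

module Submission where

-- Reflexivity, symmetry and transitivity of = are theorems of Th
-- (with free variables); m carries theorems of Th to theorems of M and
-- commutes with the connectives up to provable equivalence in M. What
-- remains is to recognise the images of the equality atoms x = y occurring
-- in those theorems as instances of E. The axioms of a modelling
-- transformation only speak about one context at a time, so we call an
-- atom var a ≐ var b "tracked" when its image is provably equivalent to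
-- E(var a, var b), and show that E's own atom is tracked and that tracked
-- atoms are closed under weakening (transport of A ⇒ ∀x A and ∃x A ⇒ A)
-- and under contracting variable 3 into another one (axiom m-sub).
-- Three weakenings and two contractions reach every atom in three
-- variables, so all three laws hold in M in three variables; substitution
-- then moves reflexivity and symmetry to their one- and two-variable forms.

open import Defs
open import Data.Fin using (Fin; zero; suc; _≟_; punchOut; inject₁)
open import Data.Nat using (ℕ; zero; suc)
open import Data.Product using (_×_; _,_; proj₁; swap)
open import Data.Vec using (Vec; []; _∷_)
open import Function using (_∘_)
open import Level using (0ℓ)
open import Relation.Binary.Bundles using (Setoid)
open import Relation.Binary.Structures using (IsEquivalence)
open import Relation.Binary.PropositionalEquality
  using (_≡_; refl; sym; trans; cong; cong₂; subst; module ≡-Reasoning)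
open import Relation.Nullary using (yes; no)
import Relation.Binary.Reasoning.Setoid as SetoidReasoning

-- Contraction: variable x is identified with j, the others are renumbered.
-- This is the renaming performed by `subAt A x (var j)`.
contract : ∀ {n} → Fin (suc n) → Fin n → Fin (suc n) → Fin n
contract x j i with x ≟ i
... | yes _  = j
... | no x≢i = punchOut x≢i

-- Variable 3, the position at which the proof contracts.
x₃ : ∀ {n} → Fin (suc (suc (suc (suc n))))
x₃ = suc (suc (suc zero))

contract-x₃-inject₁ : (a b : Fin 3) → contract x₃ a (inject₁ b) ≡ b
contract-x₃-inject₁ a zero             = refl
contract-x₃-inject₁ a (suc zero)       = refl
contract-x₃-inject₁ a (suc (suc zero)) = refl

module Substitution {L : Language} where

  open ≡-Reasoning

  mutual
    renT-as-subT : ∀ {n m} (ρ : Fin n → Fin m) (t : Term L n) →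
                   renT ρ t ≡ subT (var ∘ ρ) t
    renT-as-subT ρ (var i)   = refl
    renT-as-subT ρ (fn f ts) = cong (fn f) (renTs-as-subTs ρ ts)

    renTs-as-subTs : ∀ {n m k} (ρ : Fin n → Fin m) (ts : Vec (Term L n) k) →
                     renTs ρ ts ≡ subTs (var ∘ ρ) ts
    renTs-as-subTs ρ []       = refl
    renTs-as-subTs ρ (t ∷ ts) = cong₂ _∷_ (renT-as-subT ρ t) (renTs-as-subTs ρ ts)

  mutual
    subT-cong : ∀ {n m} {σ τ : Subst n m} → (∀ i → σ i ≡ τ i) →
                (t : Term L n) → subT σ t ≡ subT τ t
    subT-cong h (var i)   = h i
    subT-cong h (fn f ts) = cong (fn f) (subTs-cong h ts)

    subTs-cong : ∀ {n m k} {σ τ : Subst n m} → (∀ i → σ i ≡ τ i) →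
                 (ts : Vec (Term L n) k) → subTs σ ts ≡ subTs τ ts
    subTs-cong h []       = refl
    subTs-cong h (t ∷ ts) = cong₂ _∷_ (subT-cong h t) (subTs-cong h ts)

  mutual
    subT-fusion : ∀ {n m k} (σ : Subst m k) (τ : Subst n m) (t : Term L n) →
                  subT σ (subT τ t) ≡ subT (λ i → subT σ (τ i)) t
    subT-fusion σ τ (var i)   = refl
    subT-fusion σ τ (fn f ts) = cong (fn f) (subTs-fusion σ τ ts)

    subTs-fusion : ∀ {n m k j} (σ : Subst m k) (τ : Subst n m) (ts : Vec (Term L n) j) →
                   subTs σ (subTs τ ts) ≡ subTs (λ i → subT σ (τ i)) ts
    subTs-fusion σ τ []       = refl
    subTs-fusion σ τ (t ∷ ts) = cong₂ _∷_ (subT-fusion σ τ t) (subTs-fusion σ τ ts)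

  mutual
    subT-id : ∀ {n} (t : Term L n) → subT var t ≡ t
    subT-id (var i)   = refl
    subT-id (fn f ts) = cong (fn f) (subTs-id ts)

    subTs-id : ∀ {n k} (ts : Vec (Term L n) k) → subTs var ts ≡ ts
    subTs-id []       = refl
    subTs-id (t ∷ ts) = cong₂ _∷_ (subT-id t) (subTs-id ts)

  exts-cong : ∀ {n m} {σ τ : Subst n m} → (∀ i → σ i ≡ τ i) →
              ∀ i → exts {L = L} σ i ≡ exts τ i
  exts-cong h zero    = refl
  exts-cong h (suc i) = cong (renT suc) (h i)

  exts-fusion : ∀ {n m k} (σ : Subst m k) (τ : Subst n m) (i : Fin (suc n)) →
                subT (exts σ) (exts τ i) ≡ exts (λ j → subT {L = L} σ (τ j)) i
  exts-fusion σ τ zero    = refl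
  exts-fusion σ τ (suc i) = begin
    subT (exts σ) (renT suc (τ i))                ≡⟨ cong (subT (exts σ)) (renT-as-subT suc (τ i)) ⟩
    subT (exts σ) (subT (var ∘ suc) (τ i))        ≡⟨ subT-fusion (exts σ) (var ∘ suc) (τ i) ⟩
    subT (λ j → renT suc (σ j)) (τ i)             ≡⟨ subT-cong (λ j → renT-as-subT suc (σ j)) (τ i) ⟩
    subT (λ j → subT (var ∘ suc) (σ j)) (τ i)     ≡⟨ subT-fusion (var ∘ suc) σ (τ i) ⟨
    subT (var ∘ suc) (subT σ (τ i))               ≡⟨ renT-as-subT suc (subT σ (τ i)) ⟨
    renT suc (subT σ (τ i))                       ∎

  exts-id : ∀ {n} (i : Fin (suc n)) → exts {L = L} var i ≡ var i
  exts-id zero    = refl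
  exts-id (suc i) = refl

  subF-cong : ∀ {n m} {σ τ : Subst n m} → (∀ i → σ i ≡ τ i) →
              (A : Formula L n) → subF σ A ≡ subF τ A
  subF-cong h (rel r ts) = cong (rel r) (subTs-cong h ts)
  subF-cong h (t ≐ u)    = cong₂ _≐_ (subT-cong h t) (subT-cong h u)
  subF-cong h (¬' A)     = cong ¬'_ (subF-cong h A)
  subF-cong h (A ∨' B)   = cong₂ _∨'_ (subF-cong h A) (subF-cong h B)
  subF-cong h (∃' A)     = cong ∃' (subF-cong (exts-cong h) A)

  subF-fusion : ∀ {n m k} (σ : Subst m k) (τ : Subst n m) (A : Formula L n) →
                subF σ (subF τ A) ≡ subF (λ i → subT σ (τ i)) A
  subF-fusion σ τ (rel r ts) = cong (rel r) (subTs-fusion σ τ ts)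
  subF-fusion σ τ (t ≐ u)    = cong₂ _≐_ (subT-fusion σ τ t) (subT-fusion σ τ u)
  subF-fusion σ τ (¬' A)     = cong ¬'_ (subF-fusion σ τ A)
  subF-fusion σ τ (A ∨' B)   = cong₂ _∨'_ (subF-fusion σ τ A) (subF-fusion σ τ B)
  subF-fusion σ τ (∃' A)     =
    cong ∃' (trans (subF-fusion (exts σ) (exts τ) A) (subF-cong (exts-fusion σ τ) A))

  subF-id : ∀ {n} (A : Formula L n) → subF var A ≡ A
  subF-id (rel r ts) = cong (rel r) (subTs-id ts)
  subF-id (t ≐ u)    = cong₂ _≐_ (subT-id t) (subT-id u)
  subF-id (¬' A)     = cong ¬'_ (subF-id A)
  subF-id (A ∨' B)   = cong₂ _∨'_ (subF-id A) (subF-id B)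
  subF-id (∃' A)     = cong ∃' (trans (subF-cong exts-id A) (subF-id A))

  single : ∀ {n} → Term L n → Subst (suc n) n
  single t zero    = t
  single t (suc i) = var i

  sub-as-subF : ∀ {n} (A : Formula L (suc n)) (t : Term L n) → sub A t ≡ subF (single t) A
  sub-as-subF A t = subF-cong (λ { zero → refl ; (suc i) → refl }) A

  single-shift : ∀ {n} (s : Term L n) (t : Term L n) → subT (single s) (renT suc t) ≡ t
  single-shift s t = begin
    subT (single s) (renT suc t)            ≡⟨ cong (subT (single s)) (renT-as-subT suc t) ⟩
    subT (single s) (subT (var ∘ suc) t)    ≡⟨ subT-fusion (single s) (var ∘ suc) t ⟩
    subT var t                              ≡⟨ subT-id t ⟩
    t                                       ∎

  sub-commute : ∀ {n m} (σ : Subst n m) (A : Formula L (suc n)) (t : Term L n) →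
                subF σ (sub A t) ≡ sub (subF (exts σ) A) (subT σ t)
  sub-commute σ A t = begin
    subF σ (sub A t)                                   ≡⟨ cong (subF σ) (sub-as-subF A t) ⟩
    subF σ (subF (single t) A)                         ≡⟨ subF-fusion σ (single t) A ⟩
    subF (λ i → subT σ (single t i)) A                 ≡⟨ subF-cong pointwise A ⟩
    subF (λ i → subT (single (subT σ t)) (exts σ i)) A ≡⟨ subF-fusion (single (subT σ t)) (exts σ) A ⟨
    subF (single (subT σ t)) (subF (exts σ) A)         ≡⟨ sub-as-subF (subF (exts σ) A) (subT σ t) ⟨
    sub (subF (exts σ) A) (subT σ t)                   ∎
    where
    pointwise : ∀ i → subT σ (single t i) ≡ subT (single (subT σ t)) (exts σ i)
    pointwise zero    = refl
    pointwise (suc i) = sym (single-shift (subT σ t) (σ i))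

  weaken-commute : ∀ {n m} (σ : Subst n m) (B : Formula L n) →
                   subF (exts σ) (weaken B) ≡ weaken (subF σ B)
  weaken-commute σ B = begin
    subF (exts σ) (subF (var ∘ suc) B)          ≡⟨ subF-fusion (exts σ) (var ∘ suc) B ⟩
    subF (λ i → renT suc (σ i)) B               ≡⟨ subF-cong (λ i → renT-as-subT suc (σ i)) B ⟩
    subF (λ i → subT (var ∘ suc) (σ i)) B       ≡⟨ subF-fusion (var ∘ suc) σ B ⟨
    subF (var ∘ suc) (subF σ B)                 ∎

  close-invariant : ∀ {n m} (σ : Subst n m) (φ : Formula L 0) → subF σ (close φ) ≡ close φ
  close-invariant σ φ = trans (subF-fusion σ (λ ()) φ) (subF-cong (λ ()) φ)

  eqs⇒-subst : ∀ {n m k} (σ : Subst n m) (ts us : Vec (Term L n) k) (φ : Formula L n) →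
               subF σ (eqs⇒ ts us φ) ≡ eqs⇒ (subTs σ ts) (subTs σ us) (subF σ φ)
  eqs⇒-subst σ []       []       φ = refl
  eqs⇒-subst σ (t ∷ ts) (u ∷ us) φ =
    cong (λ X → ¬' (subT σ t ≐ subT σ u) ∨' X) (eqs⇒-subst σ ts us φ)

  unshift-lifted : ∀ {n} (B : Formula L (suc n)) →
                   subF (single (var zero)) (subF (exts (var ∘ suc)) B) ≡ B
  unshift-lifted B =
    trans (subF-fusion (single (var zero)) (exts (var ∘ suc)) B)
          (trans (subF-cong pointwise B) (subF-id B))
    where
    pointwise : ∀ i → subT (single (var zero)) (exts (var ∘ suc) i) ≡ var i
    pointwise zero    = refl
    pointwise (suc i) = refl

  -- `subAt` at position 3 is the contraction renaming, for every formula.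
  -- (For an abstract formula the substitution hidden in `subAt` can only be
  -- evaluated at a concrete position; position 3 is the one the proof needs.)
  subAt-x₃ : ∀ {n} (A : Formula L (suc (suc (suc (suc n))))) (j : Fin (suc (suc (suc n)))) →
             subAt A x₃ (var j) ≡ subF (var ∘ contract x₃ j) A
  subAt-x₃ A j = subF-cong
    (λ { zero                      → refl
       ; (suc zero)                → refl
       ; (suc (suc zero))          → refl
       ; (suc (suc (suc zero)))    → refl
       ; (suc (suc (suc (suc i)))) → refl })
    A

module Derivable (T : Theory) where

  open Substitution {lang T}

  Fm : ℕ → Set
  Fm = Formula (lang T)

  ⊢-sub : ∀ {n m} (σ : Subst n m) {A : Fm n} → T ⊢ A → T ⊢ subF σ A
  ⊢-sub σ (ax {φ = φ} a)       = subst (T ⊢_) (sym (close-invariant σ φ)) (ax a)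
  ⊢-sub σ (prop-ax A)          = prop-ax (subF σ A)
  ⊢-sub σ (subst-ax A t)       =
    subst (λ X → T ⊢ ¬' X ∨' ∃' (subF (exts σ) A)) (sym (sub-commute σ A t))
          (subst-ax (subF (exts σ) A) (subT σ t))
  ⊢-sub σ (refl-ax t)          = refl-ax (subT σ t)
  ⊢-sub σ (eq-fn f ts us)      =
    subst (T ⊢_) (sym (eqs⇒-subst σ ts us _)) (eq-fn f (subTs σ ts) (subTs σ us))
  ⊢-sub σ (eq-rel r ts us)     =
    subst (T ⊢_) (sym (eqs⇒-subst σ ts us _)) (eq-rel r (subTs σ ts) (subTs σ us))
  ⊢-sub σ (eq-eq t₁ t₂ u₁ u₂)  = eq-eq (subT σ t₁) (subT σ t₂) (subT σ u₁) (subT σ u₂)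
  ⊢-sub σ (expansion A d)      = expansion (subF σ A) (⊢-sub σ d)
  ⊢-sub σ (contraction d)      = contraction (⊢-sub σ d)
  ⊢-sub σ (associative d)      = associative (⊢-sub σ d)
  ⊢-sub σ (cut d e)            = cut (⊢-sub σ d) (⊢-sub σ e)
  ⊢-sub σ (∃-intro {A = A} {B} d) =
    ∃-intro (subst (λ X → T ⊢ ¬' subF (exts σ) A ∨' X) (weaken-commute σ B) (⊢-sub (exts σ) d))
  ⊢-sub σ (strengthen {A = A} d) =
    strengthen (subst (T ⊢_) (weaken-commute σ A) (⊢-sub (exts σ) d))

  module _ {n : ℕ} where

    ∨-comm : ∀ {A B : Fm n} → T ⊢ A ∨' B → T ⊢ B ∨' A
    ∨-comm {A = A} d = cut d (prop-ax A)

    ∨-rotate : ∀ {A B C : Fm n} → T ⊢ A ∨' (B ∨' C) → T ⊢ C ∨' (A ∨' B)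
    ∨-rotate d = ∨-comm (associative d)

    ∨-assocʳ : ∀ {A B C : Fm n} → T ⊢ (A ∨' B) ∨' C → T ⊢ A ∨' (B ∨' C)
    ∨-assocʳ d = ∨-rotate (∨-rotate (∨-comm d))

    mp : ∀ {A B : Fm n} → T ⊢ A → T ⊢ A ⇒ B → T ⊢ B
    mp {B = B} a ab = contraction (cut (∨-comm (expansion B a)) ab)

    ∨-mapʳ : ∀ {A B C : Fm n} → T ⊢ C ∨' A → T ⊢ A ⇒ B → T ⊢ C ∨' B
    ∨-mapʳ d ab = cut (∨-comm d) ab

    ∨-mapˡ : ∀ {A B C : Fm n} → T ⊢ A ∨' C → T ⊢ A ⇒ B → T ⊢ B ∨' C
    ∨-mapˡ d ab = ∨-comm (∨-mapʳ (∨-comm d) ab)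

    ⇒-refl : ∀ {A : Fm n} → T ⊢ A ⇒ A
    ⇒-refl {A = A} = prop-ax A

    ⇒-trans : ∀ {A B C : Fm n} → T ⊢ A ⇒ B → T ⊢ B ⇒ C → T ⊢ A ⇒ C
    ⇒-trans = ∨-mapʳ

    ¬¬-intro : ∀ {A : Fm n} → T ⊢ A ⇒ ¬' ¬' A
    ¬¬-intro {A = A} = ∨-comm (prop-ax (¬' A))

    ¬¬-elim : ∀ {A : Fm n} → T ⊢ ¬' ¬' A ⇒ A
    ¬¬-elim {A = A} = ∨-comm (cut (prop-ax A) (∨-comm (prop-ax (¬' ¬' A))))

    contrapose : ∀ {A B : Fm n} → T ⊢ A ⇒ B → T ⊢ ¬' B ⇒ ¬' A
    contrapose ab = ∨-comm (∨-mapʳ ab ¬¬-intro)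

    ∨-injˡ : ∀ {A B : Fm n} → T ⊢ A ⇒ A ∨' B
    ∨-injˡ {A = A} {B} = ∨-rotate (∨-rotate (expansion B (prop-ax A)))

    ∨-injʳ : ∀ {A B : Fm n} → T ⊢ B ⇒ A ∨' B
    ∨-injʳ {A = A} {B} = ∨-rotate (expansion A (∨-comm (prop-ax B)))

    ∨-idem : ∀ {A : Fm n} → T ⊢ A ∨' A ⇒ A
    ∨-idem {A = A} = contraction (∨-mapʳ (associative (prop-ax (A ∨' A))) ∨-injʳ)

    ∨-elim : ∀ {A B C : Fm n} → T ⊢ A ⇒ C → T ⊢ B ⇒ C → T ⊢ A ∨' B ⇒ C
    ∨-elim {A = A} {B} {C} ac bc = ∨-comm (∨-mapˡ twiceC ∨-idem)
      where
      D = ¬' (A ∨' B)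
      onceC : T ⊢ (D ∨' A) ∨' C
      onceC = ∨-mapʳ (associative (prop-ax (A ∨' B))) bc
      twiceC : T ⊢ (C ∨' C) ∨' D
      twiceC = associative (∨-comm (∨-mapʳ (associative (∨-comm onceC)) ac))

    ∨-mono : ∀ {A A′ B B′ : Fm n} → T ⊢ A ⇒ A′ → T ⊢ B ⇒ B′ → T ⊢ A ∨' B ⇒ A′ ∨' B′
    ∨-mono aa bb = ∨-elim (⇒-trans aa ∨-injˡ) (⇒-trans bb ∨-injʳ)

    exchange : ∀ {A B C : Fm n} → T ⊢ A ⇒ B ⇒ C → T ⊢ B ⇒ A ⇒ C
    exchange d = ∨-assocʳ (∨-mapˡ (associative d) (∨-elim ∨-injʳ ∨-injˡ))

    discharge : ∀ {A B C : Fm n} → T ⊢ A ⇒ B ⇒ C → T ⊢ B → T ⊢ A ⇒ C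
    discharge d b = mp b (exchange d)

    uncurry : ∀ {A B C : Fm n} → T ⊢ A ⇒ B ⇒ C → T ⊢ A ∧' B ⇒ C
    uncurry d = ∨-mapˡ (associative d) ¬¬-intro

    -- A ∧ B is ¬(¬A ∨ ¬B); each conjunct follows with the help of a tautology.
    ∧-elim : ∀ {A B C : Fm n} → T ⊢ (¬' A ∨' ¬' B) ∨' C → T ⊢ A ∧' B → T ⊢ C
    ∧-elim {C = C} taut h = contraction (cut taut (∨-comm (expansion C h)))

    ∧-projˡ : ∀ {A B : Fm n} → T ⊢ A ∧' B → T ⊢ A
    ∧-projˡ {A = A} {B} =
      ∧-elim (associative (∨-comm (associative (expansion (¬' B) (∨-comm (prop-ax A))))))

    ∧-projʳ : ∀ {A B : Fm n} → T ⊢ A ∧' B → T ⊢ B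
    ∧-projʳ {A = A} {B} = ∧-elim (associative (expansion (¬' A) (prop-ax B)))

  ∃-instance : ∀ {n} {A : Fm (suc n)} {t : Term (lang T) n} → T ⊢ subF (single t) A ⇒ ∃' A
  ∃-instance {A = A} {t} = subst (λ X → T ⊢ ¬' X ∨' ∃' A) (sub-as-subF A t) (subst-ax A t)

  ∀-instance : ∀ {n} {A : Fm (suc n)} {t : Term (lang T) n} → T ⊢ ∀' A ⇒ subF (single t) A
  ∀-instance {A = A} {t} = ⇒-trans (contrapose (∃-instance {A = ¬' A} {t})) ¬¬-elim

  ∀-intro : ∀ {n} {A : Fm (suc n)} → T ⊢ A → T ⊢ ∀' A
  ∀-intro {A = A} a =
    contraction (∃-intro (∨-comm (expansion (weaken (∀' A)) (mp a ¬¬-intro))))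

  ∀-elim : ∀ {n} {C : Fm (suc n)} → T ⊢ ∀' C → T ⊢ C
  ∀-elim {C = C} d = subst (T ⊢_) (unshift-lifted C) (mp (⊢-sub (var ∘ suc) d) ∀-instance)

  ⇒∀-elim : ∀ {n} {B : Fm n} {C : Fm (suc n)} → T ⊢ B ⇒ ∀' C → T ⊢ weaken B ⇒ C
  ⇒∀-elim {B = B} {C} d =
    subst (λ X → T ⊢ weaken B ⇒ X) (unshift-lifted C) (⇒-trans (⊢-sub (var ∘ suc) d) ∀-instance)

  ∃⇒-elim : ∀ {n} {B : Fm n} {C : Fm (suc n)} → T ⊢ ∃' C ⇒ B → T ⊢ C ⇒ weaken B
  ∃⇒-elim {B = B} {C} d =
    subst (λ X → T ⊢ X ⇒ weaken B) (unshift-lifted C) (⇒-trans ∃-instance (⊢-sub (var ∘ suc) d))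

  ∃-mono : ∀ {n} {A B : Fm (suc n)} → T ⊢ A ⇒ B → T ⊢ ∃' A ⇒ ∃' B
  ∃-mono {B = B} ab = ∃-intro (⇒-trans ab B⇒∃B)
    where
    B⇒∃B : T ⊢ B ⇒ weaken (∃' B)
    B⇒∃B = subst (λ X → T ⊢ X ⇒ weaken (∃' B)) (unshift-lifted B) ∃-instance

  vacuous-∀ : ∀ {n} {A : Fm n} → T ⊢ A ⇒ ∀' (weaken A)
  vacuous-∀ {A = A} = ∨-comm (∃-intro (prop-ax (¬' weaken A)))

  vacuous-∃ : ∀ {n} {A : Fm n} → T ⊢ ∃' (weaken A) ⇒ A
  vacuous-∃ {A = A} = ∃-intro (prop-ax (weaken A))

  ≐-sym : ∀ {n} (t u : Term (lang T) n) → T ⊢ t ≐ u ⇒ u ≐ t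
  ≐-sym t u = discharge (discharge (eq-eq t t u t) (refl-ax t)) (refl-ax t)

  ≐-trans : ∀ {n} (t u s : Term (lang T) n) → T ⊢ t ≐ u ∧' u ≐ s ⇒ t ≐ s
  ≐-trans t u s = uncurry (exchange (mp (refl-ax t) (eq-eq t u t s)))

module Modelling {Th M : Theory} (m : ModellingTransformation Th M) where

  open ModellingTransformation m
  open Substitution
  open Derivable M
  private module Th = Derivable Th

  infix 3 _≋_
  _≋_ : ∀ {n} → Formula (lang M) n → Formula (lang M) n → Set
  A ≋ B = (M ⊢ A ⇒ B) × (M ⊢ B ⇒ A)

  ≋-isEquivalence : ∀ {n} → IsEquivalence (_≋_ {n})
  ≋-isEquivalence = record
    { refl  = ⇒-refl , ⇒-refl
    ; sym   = swap
    ; trans = λ { (f , g) (f′ , g′) → ⇒-trans f f′ , ⇒-trans g′ g }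
    }

  ≋-setoid : ℕ → Setoid 0ℓ 0ℓ
  ≋-setoid n = record { isEquivalence = ≋-isEquivalence {n} }

  module ≋-Reasoning {n : ℕ} = SetoidReasoning (≋-setoid n)

  ≋-refl : ∀ {n} {A : Formula (lang M) n} → A ≋ A
  ≋-refl = IsEquivalence.refl ≋-isEquivalence

  ≋-trans : ∀ {n} {A B C : Formula (lang M) n} → A ≋ B → B ≋ C → A ≋ C
  ≋-trans = IsEquivalence.trans ≋-isEquivalence

  ⇔⇒≋ : ∀ {n} {A B : Formula (lang M) n} → M ⊢ A ⇔ B → A ≋ B
  ⇔⇒≋ h = ∧-projˡ h , ∧-projʳ h

  ⊢-≋ : ∀ {n} {A B : Formula (lang M) n} → M ⊢ A → A ≋ B → M ⊢ B
  ⊢-≋ a h = mp a (proj₁ h)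

  ≋-subF : ∀ {n k} (σ : Subst n k) {A B : Formula (lang M) n} → A ≋ B → subF σ A ≋ subF σ B
  ≋-subF σ (f , g) = ⊢-sub σ f , ⊢-sub σ g

  mF-¬ : ∀ {n} {S : Formula (lang Th) n} {Y} → mF S ≋ Y → mF (¬' S) ≋ ¬' Y
  mF-¬ {S = S} (f , g) = ≋-trans (⇔⇒≋ (m-¬ S)) (contrapose g , contrapose f)

  mF-∨ : ∀ {n} {S S′ : Formula (lang Th) n} {Y Y′} →
         mF S ≋ Y → mF S′ ≋ Y′ → mF (S ∨' S′) ≋ Y ∨' Y′
  mF-∨ {S = S} {S′} (f , g) (f′ , g′) = ≋-trans (⇔⇒≋ (m-∨ S S′)) (∨-mono f f′ , ∨-mono g g′)

  mF-∃ : ∀ {n} {P : Formula (lang Th) (suc n)} {Y} → mF P ≋ Y → mF (∃' P) ≋ ∃' Y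
  mF-∃ {P = P} (f , g) = ≋-trans (⇔⇒≋ (m-∃ P)) (∃-mono f , ∃-mono g)

  mF-⇒ : ∀ {n} {S S′ : Formula (lang Th) n} {Y Y′} →
         mF S ≋ Y → mF S′ ≋ Y′ → mF (S ⇒ S′) ≋ (Y ⇒ Y′)
  mF-⇒ h k = mF-∨ (mF-¬ h) k

  mF-∧ : ∀ {n} {S S′ : Formula (lang Th) n} {Y Y′} →
         mF S ≋ Y → mF S′ ≋ Y′ → mF (S ∧' S′) ≋ (Y ∧' Y′)
  mF-∧ h k = mF-¬ (mF-∨ (mF-¬ h) (mF-¬ k))

  mF-∀ : ∀ {n} {P : Formula (lang Th) (suc n)} {Y} → mF P ≋ Y → mF (∀' P) ≋ ∀' Y
  mF-∀ h = mF-¬ (mF-∃ (mF-¬ h))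

  -- m preserves provability of formulas with free variables as well:
  -- generalise in Th, transport the sentence, and instantiate in M.
  m-prov-open : ∀ {n} (S : Formula (lang Th) n) → Th ⊢ S → M ⊢ mF S
  m-prov-open {zero}  S d = m-prov S d
  m-prov-open {suc n} S d = ∀-elim (⊢-≋ (m-prov-open (∀' S) (Th.∀-intro d)) (mF-∀ ≋-refl))

  transfer : ∀ {n} {S : Formula (lang Th) n} {Y} → Th ⊢ S → mF S ≋ Y → M ⊢ Y
  transfer {S = S} d h = ⊢-≋ (m-prov-open S d) h

  -- m commutes with weakening: transport A ⇒ ∀x A and ∃x A ⇒ A (x fresh).
  m-weaken : ∀ {n} (A : Formula (lang Th) n) → mF (weaken A) ≋ weaken (mF A)
  m-weaken A =
    ∃⇒-elim (transfer (Th.vacuous-∃ {A = A}) (mF-⇒ (mF-∃ ≋-refl) ≋-refl)) ,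
    ⇒∀-elim (transfer (Th.vacuous-∀ {A = A}) (mF-⇒ ≋-refl (mF-∀ ≋-refl)))

  m-subAt : ∀ {n} (P : Formula (lang Th) (suc n)) (x : Fin (suc n)) (j : Fin n) →
            mF (subAt P x (var j)) ≋ subAt (mF P) x (var j)
  m-subAt P x j =
    subst (λ u → mF (subAt P x (var j)) ≋ subAt (mF P) x u) (m-var j) (⇔⇒≋ (m-sub P x (var j)))

  E-subst : ∀ {n k} (σ : Subst n k) (s t : Term (lang M) n) →
            subF σ (E[_,_] m s t) ≡ E[_,_] m (subT σ s) (subT σ t)
  E-subst σ s t = trans (subF-fusion σ _ (E m)) (subF-cong (λ { zero → refl ; (suc _) → refl }) (E m))

  Tracks : ∀ {n} → Fin n → Fin n → Set
  Tracks a b = mF (var a ≐ var b) ≋ E[_,_] m (var a) (var b)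

  tracks-E : Tracks {2} (suc zero) zero
  tracks-E = begin
    E m                                    ≡⟨ subF-id (E m) ⟨
    subF var (E m)                         ≡⟨ subF-cong (λ { zero → refl ; (suc zero) → refl }) (E m) ⟩
    E[_,_] m (var (suc zero)) (var zero)   ∎
    where open ≋-Reasoning

  tracks-weaken : ∀ {n} {a b : Fin n} → Tracks a b → Tracks (suc a) (suc b)
  tracks-weaken {a = a} {b} tracked = begin
    mF (weaken (var a ≐ var b))            ≈⟨ m-weaken (var a ≐ var b) ⟩
    weaken (mF (var a ≐ var b))            ≈⟨ ≋-subF (var ∘ suc) tracked ⟩
    weaken (E[_,_] m (var a) (var b))      ≡⟨ E-subst (var ∘ suc) (var a) (var b) ⟩
    E[_,_] m (var (suc a)) (var (suc b))   ∎
    where open ≋-Reasoning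

  tracks-contract : ∀ {n} {a b : Fin (suc (suc (suc (suc n))))} (j : Fin (suc (suc (suc n)))) →
                    Tracks a b → Tracks (contract x₃ j a) (contract x₃ j b)
  tracks-contract {n} {a} {b} j tracked = begin
    mF (subF ρ (var a ≐ var b))             ≡⟨ cong mF (subAt-x₃ (var a ≐ var b) j) ⟨
    mF (subAt (var a ≐ var b) x₃ (var j))   ≈⟨ m-subAt (var a ≐ var b) x₃ j ⟩
    subAt (mF (var a ≐ var b)) x₃ (var j)   ≡⟨ subAt-x₃ (mF (var a ≐ var b)) j ⟩
    subF ρ (mF (var a ≐ var b))             ≈⟨ ≋-subF ρ tracked ⟩
    subF ρ (E[_,_] m (var a) (var b))       ≡⟨ E-subst ρ (var a) (var b) ⟩
    E[_,_] m (subT ρ (var a)) (subT ρ (var b)) ∎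
    where
    open ≋-Reasoning
    ρ : ∀ {L} → Subst {L} (suc (suc (suc (suc n)))) (suc (suc (suc n)))
    ρ = var ∘ contract x₃ j

  -- Every atom in three variables is tracked: weaken E's atom (1,0) to
  -- (4,3) and contract variable 3 twice, first into b, then into a.
  tracks₃ : (a b : Fin 3) → Tracks a b
  tracks₃ a b = subst (Tracks a) (contract-x₃-inject₁ a b)
    (tracks-contract a (tracks-contract (inject₁ b)
      (tracks-weaken (tracks-weaken (tracks-weaken tracks-E)))))

  v₀ : ∀ {n} → Term (lang M) (suc n)
  v₀ = var zero

  v₁ : ∀ {n} → Term (lang M) (suc (suc n))
  v₁ = var (suc zero)

  v₂ : ∀ {n} → Term (lang M) (suc (suc (suc n)))
  v₂ = var (suc (suc zero))

  -- The three laws, first in three variables, then moved to their own contexts.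
  E-reflexive : M ⊢ ∀' (E[_,_] m v₀ v₀)
  E-reflexive = ∀-intro (subst (M ⊢_) (E-subst σ v₀ v₀) (⊢-sub σ refl₃))
    where
    refl₃ : M ⊢ E[_,_] m {n = 3} v₀ v₀
    refl₃ = transfer (refl-ax (var zero)) (tracks₃ zero zero)
    σ : Subst 3 1
    σ _ = var zero

  E-symmetric : M ⊢ ∀' (∀' (E[_,_] m v₁ v₀ ⇒ E[_,_] m v₀ v₁))
  E-symmetric = ∀-intro (∀-intro
    (subst (M ⊢_) (cong₂ _⇒_ (E-subst σ v₁ v₀) (E-subst σ v₀ v₁)) (⊢-sub σ sym₃)))
    where
    sym₃ : M ⊢ E[_,_] m {n = 3} v₁ v₀ ⇒ E[_,_] m v₀ v₁
    sym₃ = transfer (Th.≐-sym (var (suc zero)) (var zero))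
                    (mF-⇒ (tracks₃ (suc zero) zero) (tracks₃ zero (suc zero)))
    σ : Subst 3 2
    σ zero             = var zero
    σ (suc zero)       = var (suc zero)
    σ (suc (suc zero)) = var zero

  E-transitive : M ⊢ ∀' (∀' (∀' ((E[_,_] m v₂ v₁ ∧' E[_,_] m v₁ v₀) ⇒ E[_,_] m v₂ v₀)))
  E-transitive = ∀-intro (∀-intro (∀-intro (transfer
    (Th.≐-trans (var (suc (suc zero))) (var (suc zero)) (var zero))
    (mF-⇒ (mF-∧ (tracks₃ (suc (suc zero)) (suc zero)) (tracks₃ (suc zero) zero))
          (tracks₃ (suc (suc zero)) zero)))))

mainTheorem1 : (Th M : Theory) (m : ModellingTransformation Th M) →
    (_⊢_ M {0} (∀' (E[_,_] m (var zero) (var zero))))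
    × (_⊢_ M {0} (∀' (∀' (E[_,_] m (var (suc zero)) (var zero) ⇒ E[_,_] m (var zero) (var (suc zero))))))
    × (_⊢_ M {0} (∀' (∀' (∀' ((E[_,_] m (var (suc (suc zero))) (var (suc zero)) ∧' E[_,_] m (var (suc zero)) (var zero)) ⇒ E[_,_] m (var (suc (suc zero))) (var zero))))))
mainTheorem1 Th M m = E-reflexive , E-symmetric , E-transitive
  where open Modelling m
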